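{- Let $r \geqslant 0$ and $k \geqslant 1$ be integers, and let $t \geqslant 2$ and $1 \leqslant n_1 \leqslant n_2 \leqslant \cdots \leqslant n_t$ be integers. The complete $t$-partite graph $K_{n_1,n_2,\ldots,n_t}$ has an $r$-equitable $k$-coloring if and only if at least one of the following statements holds: (1) $r \geqslant 1$ and $k \geqslant \left(\sum_{i=1}^t \lceil n_i/r \rceil\right) + 1$; (2) there exists a positive integer $m$ such that $\lfloor n_i/m \rfloor \geqslant \lceil n_i/(m+r) \rceil$ for all $1 \leqslant i \leqslant t$ and $\sum_{i=1}^t \lfloor n_i/m \rfloor \geqslant k \geqslant \sum_{i=1}^t \lceil n_i/(m+r) \rceil$.
   Context: All graphs are finite, simple and undirected. For a positive integer $k$, a (proper) $k$-coloring of a graph $G=(V,E)$ is a map $f: V \to \{1,\ldots,k\}$ with $f(u)\neq f(v)$ whenever $uv \in E$; the color classes are the sets $\{u \in V : f(u)=c\}$ for $c=1,\ldots,k$, and these may be empty. For an integer $r \geqslant 0$, a $k$-coloring is $r$-equitable if the sizes of any two of its $k$ color classes (including empty ones) differ by at most $r$. $K_{n_1,\ldots,n_t}$ denotes the complete $t$-partite graph whose vertex set is partitioned into independent sets $V_1,\ldots,V_t$ with $|V_i|=n_i$, every vertex of $V_i$ adjacent to every vertex of $V_j$ for $i \neq j$. -}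

module Defs where

open import Data.Nat using (ℕ; zero; suc; _+_; _∸_; _≤_; NonZero)
open import Data.Nat.DivMod using (_/_)
open import Data.Fin using (Fin; zero; suc; _≟_)
open import Data.Bool using (Bool; true; false)
open import Data.Product using (Σ; _,_)
open import Relation.Binary.PropositionalEquality using (_≡_; _≢_)
open import Relation.Nullary.Decidable using (⌊_⌋)

sumFin : (t : ℕ) → (Fin t → ℕ) → ℕ
sumFin zero    f = 0
sumFin (suc t) f = f zero + sumFin t (λ i → f (suc i))

countFin : (m : ℕ) → (Fin m → Bool) → ℕ
countFin m p = sumFin m (λ i → bool→ℕ (p i))
  where
  bool→ℕ : Bool → ℕ
  bool→ℕ true  = 1
  bool→ℕ false = 0

-- floor division ⌊ a / b ⌋ (only used with b ≥ 1; the value at b = 0 is an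
-- irrelevant convention)
⌊_/_⌋ : ℕ → ℕ → ℕ
⌊ a / zero ⌋  = 0
⌊ a / suc b ⌋ = a / suc b

-- ceiling division ⌈ a / b ⌉ (only used with b ≥ 1)
⌈_/_⌉ : ℕ → ℕ → ℕ
⌈ a / zero ⌉  = 0
⌈ a / suc b ⌉ = (a + b) / suc b

KVertex : (t : ℕ) → (Fin t → ℕ) → Set
KVertex t n = Σ (Fin t) (λ i → Fin (n i))

KAdj : (t : ℕ) (n : Fin t → ℕ) → KVertex t n → KVertex t n → Set
KAdj t n (i , _) (j , _) = i ≢ j

IsProperColoring : (t : ℕ) (n : Fin t → ℕ) (k : ℕ) → (KVertex t n → Fin k) → Set
IsProperColoring t n k f = ∀ u v → KAdj t n u v → f u ≢ f v

classSize : (t : ℕ) (n : Fin t → ℕ) (k : ℕ) → (KVertex t n → Fin k) → Fin k → ℕ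
classSize t n k f c = sumFin t (λ i → countFin (n i) (λ a → ⌊ f (i , a) ≟ c ⌋))

-- any two of the k colour classes (empty ones included) differ in size by at most r
IsREquitable : (t : ℕ) (n : Fin t → ℕ) (k r : ℕ) → (KVertex t n → Fin k) → Set
IsREquitable t n k r f = ∀ c d → classSize t n k f c ≤ classSize t n k f d + r

HasREquitableColoring : (t : ℕ) (n : Fin t → ℕ) (k r : ℕ) → Set
HasREquitableColoring t n k r =
  Σ (KVertex t n → Fin k) (λ f → Σ (IsProperColoring t n k f) (λ _ → IsREquitable t n k r f))

-- Two vertices of the same color are nonadjacent, so in a proper coloring of
-- K_{n_1,…,n_t} every color class lies inside a single part.  Let m be the smallest
-- class size; r-equitability puts every class size in [m, m + r].  If m ≥ 1, the
-- number c_i of colors used on part i satisfies c_i m ≤ n_i ≤ c_i (m + r), that is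
-- ⌈n_i/(m+r)⌉ ≤ c_i ≤ ⌊n_i/m⌋, and the c_i add up to k: condition (2).  If m = 0, all
-- classes have size at most r (so r ≥ 1), hence c_i ≥ ⌈n_i/r⌉, while the empty class
-- forces Σ c_i ≤ k - 1: condition (1).  Conversely, choose c_i in these ranges with
-- Σ c_i = k, split part i into c_i classes with sizes in [m, m + r] (respectively
-- [0, r]) and give different parts disjoint blocks of colors.

module Submission where

open import Defs
open import Data.Nat.Properties hiding (_≟_; suc-injective)
open import Algebra.Properties.CommutativeMonoid.Sum +-0-commutativeMonoid using (sum; sum-cong-≗; ∑-comm)
open import Data.Bool using (Bool; true; false)
open import Data.Fin using (Fin; zero; suc; _≟_; _↑ˡ_; _↑ʳ_; splitAt; fromℕ<) renaming (_≤_ to _≤ᶠ_)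
open import Data.Fin.Properties using (suc-injective; ↑ˡ-injective; ↑ʳ-injective; splitAt-↑ˡ; splitAt-↑ʳ; splitAt⁻¹-↑ˡ; splitAt⁻¹-↑ʳ)
open import Data.Nat using (ℕ; zero; suc; _+_; _*_; _∸_; _≤_; _<_; _≥_; z≤n; s≤s; s≤s⁻¹; _≤?_; _<?_)
open import Data.Nat.DivMod using (_%_; m*n/n≡m; m/n*n≤m; /-monoˡ-≤; m<n*o⇒m/o<n; m≡m%n+[m/n]*n; m%n<n)
open import Data.Product using (Σ; ∃; ∃₂; _×_; _,_; proj₁; proj₂; map; map₂)
open import Data.Sum using (_⊎_; inj₁; inj₂; [_,_]′)
open import Function using (_∘_; const; id)
open import Function.Bundles using (_⇔_; mk⇔; Equivalence)
open import Function.Definitions using (Injective)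
open import Relation.Binary.PropositionalEquality
open import Relation.Nullary using (¬_; Dec; yes; no; contradiction)
open import Relation.Nullary.Decidable using (⌊_⌋; decidable-stable)

⌊⌋-true : ∀ {A : Set} (d : Dec A) → A → ⌊ d ⌋ ≡ true
⌊⌋-true (yes _) _ = refl
⌊⌋-true (no ¬a) a = contradiction a ¬a

⌊⌋-false : ∀ {A : Set} (d : Dec A) → ¬ A → ⌊ d ⌋ ≡ false
⌊⌋-false (yes a) ¬a = contradiction a ¬a
⌊⌋-false (no _)  _  = refl

⌊⌋-true⇒ : ∀ {A : Set} (d : Dec A) → ⌊ d ⌋ ≡ true → A
⌊⌋-true⇒ (yes a) _  = a
⌊⌋-true⇒ (no _)  ()

⌊⌋-⇔ : ∀ {A B : Set} → A ⇔ B → (d : Dec A) (e : Dec B) → ⌊ d ⌋ ≡ ⌊ e ⌋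
⌊⌋-⇔ A⇔B (yes a) e = sym (⌊⌋-true e (Equivalence.to A⇔B a))
⌊⌋-⇔ A⇔B (no ¬a) e = sym (⌊⌋-false e (¬a ∘ Equivalence.from A⇔B))

↑ˡ≢↑ʳ : ∀ {m n} (i : Fin m) (j : Fin n) → i ↑ˡ n ≢ m ↑ʳ j
↑ˡ≢↑ʳ zero    j ()
↑ˡ≢↑ʳ (suc i) j eq = ↑ˡ≢↑ʳ i j (suc-injective eq)

↑-elim : ∀ m {n} {P : Fin (m + n) → Set} →
         (∀ i → P (i ↑ˡ n)) → (∀ j → P (m ↑ʳ j)) → ∀ x → P x
↑-elim m {P = P} left right x with splitAt m x in eq
... | inj₁ i = subst P (splitAt⁻¹-↑ˡ eq) (left i)
... | inj₂ j = subst P (splitAt⁻¹-↑ʳ eq) (right j)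

∃-argmin : ∀ {k} (s : Fin k → ℕ) → Fin k → ∃ λ c → ∀ d → s c ≤ s d
∃-argmin {suc zero}    s _ = zero , λ { zero → ≤-refl }
∃-argmin {suc (suc k)} s _ with ∃-argmin (s ∘ suc) zero
... | c , min with s zero ≤? s (suc c)
...   | yes s₀≤ = zero  , λ { zero → ≤-refl ; (suc d) → ≤-trans s₀≤ (min d) }
...   | no  s₀≰ = suc c , λ { zero → <⇒≤ (≰⇒> s₀≰) ; (suc d) → min d }

-- Finite sums and counts

sumFin-cong : ∀ t {f g : Fin t → ℕ} → (∀ i → f i ≡ g i) → sumFin t f ≡ sumFin t g
sumFin-cong zero    eq = refl
sumFin-cong (suc t) eq = cong₂ _+_ (eq zero) (sumFin-cong t (eq ∘ suc))

sumFin-zero : ∀ t {f : Fin t → ℕ} → (∀ i → f i ≡ 0) → sumFin t f ≡ 0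
sumFin-zero zero    eq = refl
sumFin-zero (suc t) eq = cong₂ _+_ (eq zero) (sumFin-zero t (eq ∘ suc))

sumFin-const : ∀ t x → sumFin t (const x) ≡ t * x
sumFin-const zero    x = refl
sumFin-const (suc t) x = cong (x +_) (sumFin-const t x)

sumFin-ones : ∀ t → sumFin t (const 1) ≡ t
sumFin-ones t = trans (sumFin-const t 1) (*-identityʳ t)

sumFin-mono-≤ : ∀ t {f g : Fin t → ℕ} → (∀ i → f i ≤ g i) → sumFin t f ≤ sumFin t g
sumFin-mono-≤ zero    le = z≤n
sumFin-mono-≤ (suc t) le = +-mono-≤ (le zero) (sumFin-mono-≤ t (le ∘ suc))

sumFin-mono-< : ∀ t {f g : Fin t → ℕ} i → (∀ j → f j ≤ g j) → f i < g i → sumFin t f < sumFin t g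
sumFin-mono-< (suc t) zero    le lt = +-mono-<-≤ lt (sumFin-mono-≤ t (le ∘ suc))
sumFin-mono-< (suc t) (suc i) le lt = +-mono-≤-< (le zero) (sumFin-mono-< t i (le ∘ suc) lt)

f≤sumFin : ∀ t (f : Fin t → ℕ) i → f i ≤ sumFin t f
f≤sumFin (suc t) f zero    = m≤m+n (f zero) _
f≤sumFin (suc t) f (suc i) = m≤n⇒m≤o+n (f zero) (f≤sumFin t (f ∘ suc) i)

sumFin-single : ∀ t (f : Fin t → ℕ) i → (∀ j → j ≢ i → f j ≡ 0) → sumFin t f ≡ f i
sumFin-single (suc t) f zero eq =
  trans (cong (f zero +_) (sumFin-zero t (λ j → eq (suc j) λ ()))) (+-identityʳ (f zero))
sumFin-single (suc t) f (suc i) eq =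
  trans (cong (_+ sumFin t (f ∘ suc)) (eq zero λ ()))
        (sumFin-single t (f ∘ suc) i (λ j j≢i → eq (suc j) (j≢i ∘ suc-injective)))

sumFin>0⇒∃ : ∀ t (f : Fin t → ℕ) → 0 < sumFin t f → ∃ λ i → 0 < f i
sumFin>0⇒∃ (suc t) f pos with 0 <? f zero
... | yes f₀>0 = zero , f₀>0
... | no  f₀≯0 = map suc id (sumFin>0⇒∃ t (f ∘ suc) (subst (λ x → 0 < x + sumFin t (f ∘ suc)) f₀≡0 pos))
  where
  f₀≡0 : f zero ≡ 0
  f₀≡0 = n≤0⇒n≡0 (≮⇒≥ f₀≯0)

sumFin-++ : ∀ m n (f : Fin (m + n) → ℕ) →
            sumFin (m + n) f ≡ sumFin m (f ∘ (_↑ˡ n)) + sumFin n (f ∘ (m ↑ʳ_))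
sumFin-++ zero    n f = refl
sumFin-++ (suc m) n f = trans (cong (f zero +_) (sumFin-++ m n (f ∘ suc))) (sym (+-assoc (f zero) _ _))

sumFin≡sum : ∀ t (f : Fin t → ℕ) → sumFin t f ≡ sum f
sumFin≡sum zero    f = refl
sumFin≡sum (suc t) f = cong (f zero +_) (sumFin≡sum t (f ∘ suc))

sumFin-swap : ∀ t k (g : Fin t → Fin k → ℕ) →
              sumFin t (λ i → sumFin k (g i)) ≡ sumFin k (λ c → sumFin t (λ i → g i c))
sumFin-swap t k g = begin
  sumFin t (λ i → sumFin k (g i))          ≡⟨ sumFin≡sum t _ ⟩
  sum (λ i → sumFin k (g i))               ≡⟨ sum-cong-≗ (λ i → sumFin≡sum k (g i)) ⟩
  sum (λ i → sum (g i))                    ≡⟨ ∑-comm g ⟩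
  sum (λ c → sum (λ i → g i c))            ≡⟨ sum-cong-≗ (λ c → sumFin≡sum t (λ i → g i c)) ⟨
  sum (λ c → sumFin t (λ i → g i c))       ≡⟨ sumFin≡sum k _ ⟨
  sumFin k (λ c → sumFin t (λ i → g i c))  ∎
  where open ≡-Reasoning

_∈[_,_] : ℕ → ℕ → ℕ → Set
x ∈[ lo , hi ] = lo ≤ x × x ≤ hi

∃-+≡-between : ∀ {a₁ b₁ a₂ b₂ k} → a₁ ≤ b₁ → a₂ ≤ b₂ → a₁ + a₂ ≤ k → k ≤ b₁ + b₂ →
               ∃₂ λ x y → x ∈[ a₁ , b₁ ] × y ∈[ a₂ , b₂ ] × x + y ≡ k
∃-+≡-between {a₁} {b₁} {a₂} {k = k} a₁≤b₁ a₂≤b₂ lo hi with k ∸ a₂ ≤? b₁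
... | yes k∸a₂≤b₁ = k ∸ a₂ , a₂ , (m+n≤o⇒m≤o∸n a₁ lo , k∸a₂≤b₁) , (≤-refl , a₂≤b₂) , m∸n+n≡m a₂≤k
  where
  a₂≤k : a₂ ≤ k
  a₂≤k = m+n≤o⇒n≤o a₁ lo
... | no  k∸a₂≰b₁ = b₁ , k ∸ b₁ , (a₁≤b₁ , ≤-refl) , (a₂≤k∸b₁ , m≤n+o⇒m∸n≤o k b₁ hi) , m+[n∸m]≡n b₁≤k
  where
  b₁+a₂≤k : b₁ + a₂ ≤ k
  b₁+a₂≤k = m≤o∸n⇒m+n≤o b₁ (m+n≤o⇒n≤o a₁ lo) (<⇒≤ (≰⇒> k∸a₂≰b₁))
  a₂≤k∸b₁ : a₂ ≤ k ∸ b₁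
  a₂≤k∸b₁ = m+n≤o⇒m≤o∸n a₂ (subst (_≤ k) (+-comm b₁ a₂) b₁+a₂≤k)
  b₁≤k : b₁ ≤ k
  b₁≤k = m+n≤o⇒m≤o b₁ b₁+a₂≤k

∃-sumFin≡-between : ∀ t (a b : Fin t → ℕ) {k} → (∀ i → a i ≤ b i) → sumFin t a ≤ k → k ≤ sumFin t b →
                    ∃ λ c → (∀ i → c i ∈[ a i , b i ]) × sumFin t c ≡ k
∃-sumFin≡-between zero    a b a≤b lo hi = (λ ()) , (λ ()) , sym (n≤0⇒n≡0 hi)
∃-sumFin≡-between (suc t) a b a≤b lo hi
  with ∃-+≡-between (a≤b zero) (sumFin-mono-≤ t (a≤b ∘ suc)) lo hi
... | x , y , x∈ , (Σa≤y , y≤Σb) , x+y≡k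
  with ∃-sumFin≡-between t (a ∘ suc) (b ∘ suc) (a≤b ∘ suc) Σa≤y y≤Σb
...   | c , c∈ , Σc≡y = (λ { zero → x ; (suc i) → c i })
                      , (λ { zero → x∈ ; (suc i) → c∈ i })
                      , trans (cong (x +_) Σc≡y) x+y≡k

-- countFin uses a private copy of this function, so countFin-sumFin needs a proof.
bool→ℕ : Bool → ℕ
bool→ℕ true  = 1
bool→ℕ false = 0

bool→ℕ≤1 : ∀ b → bool→ℕ b ≤ 1
bool→ℕ≤1 true  = ≤-refl
bool→ℕ≤1 false = z≤n

bool→ℕ>0⇒true : ∀ {b} → 0 < bool→ℕ b → b ≡ true
bool→ℕ>0⇒true {true} _ = refl

countFin-sumFin : ∀ m (p : Fin m → Bool) → countFin m p ≡ sumFin m (bool→ℕ ∘ p)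
countFin-sumFin zero    p = refl
countFin-sumFin (suc m) p with p zero
... | true  = cong suc (countFin-sumFin m (p ∘ suc))
... | false = countFin-sumFin m (p ∘ suc)

countFin-cong : ∀ m {p q : Fin m → Bool} → (∀ a → p a ≡ q a) → countFin m p ≡ countFin m q
countFin-cong m {p} {q} eq = begin
  countFin m p          ≡⟨ countFin-sumFin m p ⟩
  sumFin m (bool→ℕ ∘ p) ≡⟨ sumFin-cong m (cong bool→ℕ ∘ eq) ⟩
  sumFin m (bool→ℕ ∘ q) ≡⟨ countFin-sumFin m q ⟨
  countFin m q          ∎
  where open ≡-Reasoning

countFin-none : ∀ m {p : Fin m → Bool} → (∀ a → p a ≡ false) → countFin m p ≡ 0
countFin-none m {p} eq = trans (countFin-sumFin m p) (sumFin-zero m (cong bool→ℕ ∘ eq))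

countFin-all : ∀ m {p : Fin m → Bool} → (∀ a → p a ≡ true) → countFin m p ≡ m
countFin-all m {p} eq =
  trans (countFin-sumFin m p) (trans (sumFin-cong m (cong bool→ℕ ∘ eq)) (sumFin-ones m))

countFin-single : ∀ m {p : Fin m → Bool} a → p a ≡ true → (∀ b → b ≢ a → p b ≡ false) →
                  countFin m p ≡ 1
countFin-single m {p} a pa others = trans (countFin-sumFin m p)
  (trans (sumFin-single m _ a (λ b b≢a → cong bool→ℕ (others b b≢a))) (cong bool→ℕ pa))

countFin-pos : ∀ m {p : Fin m → Bool} a → p a ≡ true → 0 < countFin m p
countFin-pos m {p} a pa = begin-strict
  0                     <⟨ subst (λ b → 0 < bool→ℕ b) (sym pa) ≤-refl ⟩
  bool→ℕ (p a)          ≤⟨ f≤sumFin m (bool→ℕ ∘ p) a ⟩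
  sumFin m (bool→ℕ ∘ p) ≡⟨ countFin-sumFin m p ⟨
  countFin m p          ∎
  where open ≤-Reasoning

countFin<m : ∀ m {p : Fin m → Bool} a → p a ≡ false → countFin m p < m
countFin<m m {p} a pa = begin-strict
  countFin m p          ≡⟨ countFin-sumFin m p ⟩
  sumFin m (bool→ℕ ∘ p) <⟨ sumFin-mono-< m a (bool→ℕ≤1 ∘ p) (subst (λ b → bool→ℕ b < 1) (sym pa) ≤-refl) ⟩
  sumFin m (const 1)    ≡⟨ sumFin-ones m ⟩
  m                     ∎
  where open ≤-Reasoning

countFin>0⇒∃ : ∀ m (p : Fin m → Bool) → 0 < countFin m p → ∃ λ a → p a ≡ true
countFin>0⇒∃ m p pos =
  map₂ bool→ℕ>0⇒true (sumFin>0⇒∃ m (bool→ℕ ∘ p) (subst (0 <_) (countFin-sumFin m p) pos))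

countFin-swap : ∀ t k (q : Fin t → Fin k → Bool) →
                sumFin t (λ i → countFin k (q i)) ≡ sumFin k (λ c → countFin t (λ i → q i c))
countFin-swap t k q = begin
  sumFin t (λ i → countFin k (q i))                ≡⟨ sumFin-cong t (λ i → countFin-sumFin k (q i)) ⟩
  sumFin t (λ i → sumFin k (bool→ℕ ∘ q i))         ≡⟨ sumFin-swap t k (λ i c → bool→ℕ (q i c)) ⟩
  sumFin k (λ c → sumFin t (λ i → bool→ℕ (q i c))) ≡⟨ sumFin-cong k (λ c → countFin-sumFin t (λ i → q i c)) ⟨
  sumFin k (λ c → countFin t (λ i → q i c))        ∎
  where open ≡-Reasoning

countFin-++ : ∀ m n (p : Fin (m + n) → Bool) →
              countFin (m + n) p ≡ countFin m (p ∘ (_↑ˡ n)) + countFin n (p ∘ (m ↑ʳ_))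
countFin-++ m n p = begin
  countFin (m + n) p                                       ≡⟨ countFin-sumFin (m + n) p ⟩
  sumFin (m + n) (bool→ℕ ∘ p)                              ≡⟨ sumFin-++ m n (bool→ℕ ∘ p) ⟩
  sumFin m (bool→ℕ ∘ p ∘ (_↑ˡ n)) + sumFin n (bool→ℕ ∘ p ∘ (m ↑ʳ_))
    ≡⟨ cong₂ _+_ (countFin-sumFin m (p ∘ (_↑ˡ n))) (countFin-sumFin n (p ∘ (m ↑ʳ_))) ⟨
  countFin m (p ∘ (_↑ˡ n)) + countFin n (p ∘ (m ↑ʳ_))      ∎
  where open ≡-Reasoning

nonzeros : ∀ k → (Fin k → ℕ) → ℕ
nonzeros k g = countFin k (λ c → ⌊ 0 <? g c ⌋)

nonzeros*≤sumFin : ∀ k (g : Fin k → ℕ) {lo} → (∀ c → 0 < g c → lo ≤ g c) → nonzeros k g * lo ≤ sumFin k g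
nonzeros*≤sumFin zero    g lo≤ = z≤n
nonzeros*≤sumFin (suc k) g lo≤ with 0 <? g zero
... | yes g₀>0 = +-mono-≤ (lo≤ zero g₀>0) (nonzeros*≤sumFin k (g ∘ suc) (lo≤ ∘ suc))
... | no  _    = m≤n⇒m≤o+n (g zero) (nonzeros*≤sumFin k (g ∘ suc) (lo≤ ∘ suc))

sumFin≤nonzeros* : ∀ k (g : Fin k → ℕ) {hi} → (∀ c → g c ≤ hi) → sumFin k g ≤ nonzeros k g * hi
sumFin≤nonzeros* zero    g ≤hi = z≤n
sumFin≤nonzeros* (suc k) g ≤hi with 0 <? g zero
... | yes _     = +-mono-≤ (≤hi zero) (sumFin≤nonzeros* k (g ∘ suc) (≤hi ∘ suc))
... | no  g₀≯0 rewrite n≤0⇒n≡0 (≮⇒≥ g₀≯0) = sumFin≤nonzeros* k (g ∘ suc) (≤hi ∘ suc)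

-- Floor and ceiling division

≤⌊/⌋⇔*≤ : ∀ c n h → c ≤ ⌊ n / suc h ⌋ ⇔ c * suc h ≤ n
≤⌊/⌋⇔*≤ c n h = mk⇔
  (λ c≤n/h → ≤-trans (*-monoˡ-≤ (suc h) c≤n/h) (m/n*n≤m n (suc h)))
  (λ ch≤n → subst (_≤ ⌊ n / suc h ⌋) (m*n/n≡m c (suc h)) (/-monoˡ-≤ (suc h) ch≤n))

⌈/⌉≤⇔≤* : ∀ c n h → ⌈ n / suc h ⌉ ≤ c ⇔ n ≤ c * suc h
⌈/⌉≤⇔≤* c n h = mk⇔
  (λ ⌈n/h⌉≤c → ≤-trans n≤⌈n/h⌉*h (*-monoˡ-≤ (suc h) ⌈n/h⌉≤c))
  (λ n≤ch → s≤s⁻¹ (m<n*o⇒m/o<n (n+h<[1+c]*h n≤ch)))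
  where
  open ≤-Reasoning
  n≤⌈n/h⌉*h : n ≤ ⌈ n / suc h ⌉ * suc h
  n≤⌈n/h⌉*h = +-cancelˡ-≤ h n (⌈ n / suc h ⌉ * suc h) (begin
    h + n                                      ≡⟨ +-comm h n ⟩
    n + h                                      ≡⟨ m≡m%n+[m/n]*n (n + h) (suc h) ⟩
    (n + h) % suc h + ⌈ n / suc h ⌉ * suc h    ≤⟨ +-monoˡ-≤ _ (s≤s⁻¹ (m%n<n (n + h) (suc h))) ⟩
    h + ⌈ n / suc h ⌉ * suc h                  ∎)
  n+h<[1+c]*h : n ≤ c * suc h → n + h < suc c * suc h
  n+h<[1+c]*h n≤ch = begin-strict
    n + h             ≤⟨ +-monoˡ-≤ h n≤ch ⟩
    c * suc h + h     <⟨ +-monoʳ-< (c * suc h) (n<1+n h) ⟩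
    c * suc h + suc h ≡⟨ +-comm (c * suc h) (suc h) ⟩
    suc c * suc h     ∎

-- Fibers of maps between finite sets

fiberSize : ∀ {m k} → (Fin m → Fin k) → Fin k → ℕ
fiberSize {m} g c = countFin m (λ a → ⌊ g a ≟ c ⌋)

sumFin-fiberSize : ∀ {m k} (g : Fin m → Fin k) → sumFin k (fiberSize g) ≡ m
sumFin-fiberSize {m} {k} g = begin
  sumFin k (λ c → countFin m (λ a → ⌊ g a ≟ c ⌋)) ≡⟨ countFin-swap m k (λ a c → ⌊ g a ≟ c ⌋) ⟨
  sumFin m (λ a → countFin k (λ c → ⌊ g a ≟ c ⌋)) ≡⟨ sumFin-cong m (λ a → countFin-single k (g a)
                                                       (⌊⌋-true (g a ≟ g a) refl)
                                                       (λ c c≢ga → ⌊⌋-false (g a ≟ c) (c≢ga ∘ sym))) ⟩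
  sumFin m (const 1)                              ≡⟨ sumFin-ones m ⟩
  m                                               ∎
  where open ≡-Reasoning

fiberSize-image : ∀ {m k} (g : Fin m → Fin k) (a : Fin m) → 0 < fiberSize g (g a)
fiberSize-image {m} g a = countFin-pos m a (⌊⌋-true (g a ≟ g a) refl)

fiberSize>0⇒∃ : ∀ {m k} (g : Fin m → Fin k) {c} → 0 < fiberSize g c → ∃ λ a → g a ≡ c
fiberSize>0⇒∃ {m} g {c} pos = map₂ (⌊⌋-true⇒ (g _ ≟ c)) (countFin>0⇒∃ m _ pos)

fiberSize-∉ : ∀ {m k} (g : Fin m → Fin k) (c : Fin k) → (∀ a → g a ≢ c) → fiberSize g c ≡ 0
fiberSize-∉ {m} g c miss = countFin-none m (λ a → ⌊⌋-false (g a ≟ c) (miss a))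

fiberSize-∘-injective : ∀ {m k l} {h : Fin k → Fin l} → Injective _≡_ _≡_ h →
                        (g : Fin m → Fin k) (c : Fin k) → fiberSize (h ∘ g) (h c) ≡ fiberSize g c
fiberSize-∘-injective {m} {h = h} inj g c =
  countFin-cong m (λ a → ⌊⌋-⇔ (mk⇔ inj (cong h)) (h (g a) ≟ h c) (g a ≟ c))

fiberSize-[,]∘splitAt : ∀ {m n k} (g₁ : Fin m → Fin k) (g₂ : Fin n → Fin k) c →
                        fiberSize ([ g₁ , g₂ ]′ ∘ splitAt m) c ≡ fiberSize g₁ c + fiberSize g₂ c
fiberSize-[,]∘splitAt {m} {n} g₁ g₂ c = trans (countFin-++ m n _) (cong₂ _+_
  (countFin-cong m (λ a → cong (λ x → ⌊ [ g₁ , g₂ ]′ x ≟ c ⌋) (splitAt-↑ˡ m a n)))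
  (countFin-cong n (λ b → cong (λ x → ⌊ [ g₁ , g₂ ]′ x ≟ c ⌋) (splitAt-↑ʳ m n b))))

∃-fiberSizes≡ : ∀ k (s : Fin k → ℕ) → Σ (Fin (sumFin k s) → Fin k) λ g → ∀ c → fiberSize g c ≡ s c
∃-fiberSizes≡ zero    s = (λ ()) , (λ ())
∃-fiberSizes≡ (suc k) s with ∃-fiberSizes≡ k (s ∘ suc)
... | g , fibers = [ first , rest ]′ ∘ splitAt (s zero)
                 , λ c → trans (fiberSize-[,]∘splitAt first rest c) (sizes c)
  where
  first : Fin (s zero) → Fin (suc k)
  first _ = zero
  rest : Fin (sumFin k (s ∘ suc)) → Fin (suc k)
  rest = suc ∘ g
  sizes : ∀ c → fiberSize first c + fiberSize rest c ≡ s c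
  sizes zero = trans (cong₂ _+_ (countFin-all (s zero) (λ a → ⌊⌋-true (first a ≟ zero) refl))
                                (fiberSize-∉ rest zero (λ _ ())))
                     (+-identityʳ (s zero))
  sizes (suc c) = cong₂ _+_ (fiberSize-∉ first (suc c) (λ _ ()))
                            (trans (fiberSize-∘-injective suc-injective g c) (fibers c))

∃-fiberSizes∈ : ∀ c n {lo hi} → lo ≤ hi → c * lo ≤ n → n ≤ c * hi →
                Σ (Fin n → Fin c) λ g → ∀ j → fiberSize g j ∈[ lo , hi ]
∃-fiberSizes∈ c n {lo} {hi} lo≤hi lo≤ ≤hi
  with ∃-sumFin≡-between c (const lo) (const hi) (const lo≤hi)
         (subst (_≤ n) (sym (sumFin-const c lo)) lo≤) (subst (n ≤_) (sym (sumFin-const c hi)) ≤hi)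
... | s , s∈ , Σs≡n with ∃-fiberSizes≡ c s
...   | g , fibers = subst (λ N → Σ (Fin N → Fin c) λ g → ∀ j → fiberSize g j ∈[ lo , hi ]) Σs≡n
                       (g , λ j → subst (_∈[ lo , hi ]) (sym (fibers j)) (s∈ j))

-- Colorings of complete multipartite graphs

Condition₁ : (r k t : ℕ) → (Fin t → ℕ) → Set
Condition₁ r k t n = 1 ≤ r × k ≥ sumFin t (λ i → ⌈ n i / r ⌉) + 1

Condition₂ : (r k t : ℕ) → (Fin t → ℕ) → ℕ → Set
Condition₂ r k t n m = 1 ≤ m
  × (∀ i → ⌊ n i / m ⌋ ≥ ⌈ n i / m + r ⌉)
  × (sumFin t (λ i → ⌊ n i / m ⌋) ≥ k)
  × (k ≥ sumFin t (λ i → ⌈ n i / m + r ⌉))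

module ProperColoring {t k} {n : Fin t → ℕ} {f : KVertex t n → Fin k}
                       (proper : IsProperColoring t n k f) where

  partSize : Fin t → Fin k → ℕ
  partSize i = fiberSize (λ a → f (i , a))

  size : Fin k → ℕ
  size = classSize t n k f

  colorsOn : Fin t → ℕ
  colorsOn i = nonzeros k (partSize i)

  partSize≤size : ∀ i c → partSize i c ≤ size c
  partSize≤size i c = f≤sumFin t (λ j → partSize j c) i

  color-in-one-part : ∀ {i j c} → 0 < partSize i c → 0 < partSize j c → i ≡ j
  color-in-one-part {i} {j} p q with fiberSize>0⇒∃ _ p | fiberSize>0⇒∃ _ q
  ... | a , fa≡c | b , fb≡c = decidable-stable (i ≟ j)
    (λ i≢j → proper (i , a) (j , b) i≢j (trans fa≡c (sym fb≡c)))

  size≡partSize : ∀ {i c} → 0 < partSize i c → size c ≡ partSize i c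
  size≡partSize {i} {c} p = sumFin-single t (λ j → partSize j c) i
    (λ j j≢i → n≤0⇒n≡0 (≮⇒≥ (λ q → j≢i (color-in-one-part q p))))

  countFin-partSize>0 : ∀ c → countFin t (λ i → ⌊ 0 <? partSize i c ⌋) ≡ bool→ℕ ⌊ 0 <? size c ⌋
  countFin-partSize>0 c with 0 <? size c
  ... | no size≯0 = countFin-none t (λ i → ⌊⌋-false (0 <? partSize i c)
                      (λ p → size≯0 (<-≤-trans p (partSize≤size i c))))
  ... | yes size>0 with sumFin>0⇒∃ t (λ i → partSize i c) size>0
  ...   | i , p = countFin-single t i (⌊⌋-true (0 <? partSize i c) p)
                    (λ j j≢i → ⌊⌋-false (0 <? partSize j c) (λ q → j≢i (color-in-one-part q p)))

  sumFin-colorsOn : sumFin t colorsOn ≡ nonzeros k size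
  sumFin-colorsOn = begin
    sumFin t colorsOn                                         ≡⟨ countFin-swap t k _ ⟩
    sumFin k (λ c → countFin t (λ i → ⌊ 0 <? partSize i c ⌋)) ≡⟨ sumFin-cong k countFin-partSize>0 ⟩
    sumFin k (λ c → bool→ℕ ⌊ 0 <? size c ⌋)                   ≡⟨ countFin-sumFin k _ ⟨
    nonzeros k size                                           ∎
    where open ≡-Reasoning

  colorsOn*≤ : ∀ {lo} i → (∀ c → lo ≤ size c) → colorsOn i * lo ≤ n i
  colorsOn*≤ {lo} i lo≤ = subst (colorsOn i * lo ≤_) (sumFin-fiberSize (λ a → f (i , a)))
    (nonzeros*≤sumFin k (partSize i) (λ c p → subst (_ ≤_) (size≡partSize p) (lo≤ c)))

  ≤colorsOn* : ∀ {hi} i → (∀ c → size c ≤ hi) → n i ≤ colorsOn i * hi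
  ≤colorsOn* {hi} i ≤hi = subst (_≤ colorsOn i * hi) (sumFin-fiberSize (λ a → f (i , a)))
    (sumFin≤nonzeros* k (partSize i) (λ c → ≤-trans (partSize≤size i c) (≤hi c)))

  classes-in-range⇒condition₂ : ∀ {r} m → (∀ c → suc m ≤ size c) → (∀ c → size c ≤ suc m + r) →
                                Condition₂ r k t n (suc m)
  classes-in-range⇒condition₂ {r} m lo≤ ≤hi =
    s≤s z≤n ,
    (λ i → ≤-trans (⌈⌉≤colorsOn i) (colorsOn≤⌊⌋ i)) ,
    ≤-trans (≤-reflexive k≡sum) (sumFin-mono-≤ t colorsOn≤⌊⌋) ,
    ≤-trans (sumFin-mono-≤ t ⌈⌉≤colorsOn) (≤-reflexive (sym k≡sum))
    where
    colorsOn≤⌊⌋ : ∀ i → colorsOn i ≤ ⌊ n i / suc m ⌋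
    colorsOn≤⌊⌋ i = Equivalence.from (≤⌊/⌋⇔*≤ _ (n i) m) (colorsOn*≤ i lo≤)
    ⌈⌉≤colorsOn : ∀ i → ⌈ n i / suc m + r ⌉ ≤ colorsOn i
    ⌈⌉≤colorsOn i = Equivalence.from (⌈/⌉≤⇔≤* _ (n i) (m + r)) (≤colorsOn* i ≤hi)
    k≡sum : k ≡ sumFin t colorsOn
    k≡sum = sym (trans sumFin-colorsOn (countFin-all k (λ c → ⌊⌋-true (0 <? size c) (<-≤-trans (s≤s z≤n) (lo≤ c)))))

  empty-class⇒condition₁ : ∀ {r} c₀ → size c₀ ≡ 0 → (∀ c → size c ≤ suc r) → Condition₁ (suc r) k t n
  empty-class⇒condition₁ {r} c₀ size₀≡0 ≤hi = s≤s z≤n , (begin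
    sumFin t (λ i → ⌈ n i / suc r ⌉) + 1 ≤⟨ +-monoˡ-≤ 1 (sumFin-mono-≤ t ⌈⌉≤colorsOn) ⟩
    sumFin t colorsOn + 1                ≡⟨ cong (_+ 1) sumFin-colorsOn ⟩
    nonzeros k size + 1                  ≡⟨ +-comm _ 1 ⟩
    suc (nonzeros k size)                ≤⟨ countFin<m k c₀ (⌊⌋-false (0 <? size c₀) (<-irrefl (sym size₀≡0))) ⟩
    k                                    ∎)
    where
    open ≤-Reasoning
    ⌈⌉≤colorsOn : ∀ i → ⌈ n i / suc r ⌉ ≤ colorsOn i
    ⌈⌉≤colorsOn i = Equivalence.from (⌈/⌉≤⇔≤* _ (n i) r) (≤colorsOn* i ≤hi)

  equitable⇒condition : ∀ {r} → KVertex t n → IsREquitable t n k r f →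
                        Condition₁ r k t n ⊎ Σ ℕ (Condition₂ r k t n)
  equitable⇒condition {r} (i₀ , a₀) equitable with ∃-argmin size (f (i₀ , a₀))
  ... | c₀ , minimal with size c₀ in size₀
  ...   | suc m = inj₂ (suc m , classes-in-range⇒condition₂ m minimal
                                (λ c → subst (λ s → size c ≤ s + r) size₀ (equitable c c₀)))
  ...   | zero  = inj₁ (condition₁ r (λ c → subst (λ s → size c ≤ s + r) size₀ (equitable c c₀)))
    where
    nonempty : 0 < size (f (i₀ , a₀))
    nonempty = <-≤-trans (fiberSize-image (λ a → f (i₀ , a)) a₀) (partSize≤size i₀ (f (i₀ , a₀)))
    condition₁ : ∀ r → (∀ c → size c ≤ r) → Condition₁ r k t n
    condition₁ zero    ≤0 = contradiction (<-≤-trans nonempty (≤0 (f (i₀ , a₀)))) λ ()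
    condition₁ (suc r) ≤r = empty-class⇒condition₁ c₀ size₀ ≤r

BoundedColoring : (t : ℕ) → (Fin t → ℕ) → (k lo hi : ℕ) → Set
BoundedColoring t n k lo hi = Σ (KVertex t n → Fin k) λ f →
  IsProperColoring t n k f × (∀ c → classSize t n k f c ∈[ lo , hi ])

extend-coloring : ∀ {t} {n : Fin (suc t) → ℕ} {c₀ k lo hi} (g : Fin (n zero) → Fin c₀) →
                  (∀ j → fiberSize g j ∈[ lo , hi ]) → BoundedColoring t (n ∘ suc) k lo hi →
                  BoundedColoring (suc t) n (c₀ + k) lo hi
extend-coloring {t} {n} {c₀} {k} {lo} {hi} g g∈ (f , proper , f∈) = f⁺ , proper⁺ , ↑-elim c₀ left right
  where
  f⁺ : KVertex (suc t) n → Fin (c₀ + k)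
  f⁺ (zero  , a) = g a ↑ˡ k
  f⁺ (suc i , a) = c₀ ↑ʳ f (i , a)

  proper⁺ : IsProperColoring (suc t) n (c₀ + k) f⁺
  proper⁺ (zero  , a) (zero  , b) 0≢0 _  = 0≢0 refl
  proper⁺ (zero  , a) (suc j , b) _   eq = ↑ˡ≢↑ʳ (g a) (f (j , b)) eq
  proper⁺ (suc i , a) (zero  , b) _   eq = ↑ˡ≢↑ʳ (g b) (f (i , a)) (sym eq)
  proper⁺ (suc i , a) (suc j , b) i≢j eq = proper (i , a) (j , b) (i≢j ∘ cong suc) (↑ʳ-injective c₀ _ _ eq)

  size⁺ : Fin (c₀ + k) → ℕ
  size⁺ = classSize (suc t) n (c₀ + k) f⁺

  left : ∀ j → size⁺ (j ↑ˡ k) ∈[ lo , hi ]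
  left j = subst (_∈[ lo , hi ]) (sym size≡) (g∈ j)
    where
    size≡ : size⁺ (j ↑ˡ k) ≡ fiberSize g j
    size≡ = trans (cong₂ _+_ (fiberSize-∘-injective (↑ˡ-injective k _ _) g j)
                             (sumFin-zero t (λ i → fiberSize-∉ (λ a → f⁺ (suc i , a)) (j ↑ˡ k) (λ a eq → ↑ˡ≢↑ʳ j _ (sym eq)))))
                  (+-identityʳ (fiberSize g j))

  right : ∀ j → size⁺ (c₀ ↑ʳ j) ∈[ lo , hi ]
  right j = subst (_∈[ lo , hi ]) (sym size≡) (f∈ j)
    where
    size≡ : size⁺ (c₀ ↑ʳ j) ≡ classSize t (n ∘ suc) k f j
    size≡ = cong₂ _+_ (fiberSize-∉ (λ a → f⁺ (zero , a)) (c₀ ↑ʳ j) (λ a → ↑ˡ≢↑ʳ (g a) j))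
                      (sumFin-cong t (λ i → fiberSize-∘-injective (↑ʳ-injective c₀ _ _) (λ a → f (i , a)) j))

∃-boundedColoring : ∀ t (n c : Fin t → ℕ) {lo hi} → lo ≤ hi →
                    (∀ i → c i * lo ≤ n i) → (∀ i → n i ≤ c i * hi) →
                    BoundedColoring t n (sumFin t c) lo hi
∃-boundedColoring zero    n c lo≤hi lo≤ ≤hi = (λ { (() , _) }) , (λ { (() , _) }) , (λ ())
∃-boundedColoring (suc t) n c lo≤hi lo≤ ≤hi
  with ∃-fiberSizes∈ (c zero) (n zero) lo≤hi (lo≤ zero) (≤hi zero)
... | g , g∈ = extend-coloring g g∈ (∃-boundedColoring t (n ∘ suc) (c ∘ suc) lo≤hi (lo≤ ∘ suc) (≤hi ∘ suc))

partCounts⇒equitable : ∀ {t} {n : Fin t → ℕ} {k r lo hi} (c : Fin t → ℕ) → sumFin t c ≡ k →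
                       lo ≤ hi → hi ≤ lo + r → (∀ i → c i * lo ≤ n i) → (∀ i → n i ≤ c i * hi) →
                       HasREquitableColoring t n k r
partCounts⇒equitable {t} {n} {r = r} c refl lo≤hi hi≤lo+r lo≤ ≤hi
  with ∃-boundedColoring t n c lo≤hi lo≤ ≤hi
... | f , proper , sizes = f , proper ,
  λ c₁ c₂ → ≤-trans (proj₂ (sizes c₁)) (≤-trans hi≤lo+r (+-monoˡ-≤ r (proj₁ (sizes c₂))))

condition₁⇒equitable : ∀ {r k t} {n : Fin t → ℕ} → Fin t → Condition₁ r k t n → HasREquitableColoring t n k r
-- Classes may be empty here, so the upper bounds on the c i only need to sum to at least k.
condition₁⇒equitable {zero}              _  (() , _)
condition₁⇒equitable {suc r} {k} {t} {n} i₀ (_ , k≥)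
  with ∃-sumFin≡-between t ⌈n/r⌉ (λ i → ⌈n/r⌉ i + k) (λ i → m≤m+n _ k)
         (m+n≤o⇒m≤o _ k≥) (≤-trans (m≤n+m k (⌈n/r⌉ i₀)) (f≤sumFin t _ i₀))
  where
  ⌈n/r⌉ : Fin t → ℕ
  ⌈n/r⌉ i = ⌈ n i / suc r ⌉
... | c , c∈ , Σc≡k = partCounts⇒equitable c Σc≡k z≤n ≤-refl
  (λ i → subst (_≤ n i) (sym (*-zeroʳ (c i))) z≤n)
  (λ i → Equivalence.to (⌈/⌉≤⇔≤* (c i) (n i) r) (proj₁ (c∈ i)))

condition₂⇒equitable : ∀ {r k t} {n : Fin t → ℕ} m → Condition₂ r k t n m → HasREquitableColoring t n k r
condition₂⇒equitable zero (() , _)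
condition₂⇒equitable {r} {t = t} {n} (suc m) (_ , ⌈⌉≤⌊⌋ , k≤ , ≤k)
  with ∃-sumFin≡-between t _ _ ⌈⌉≤⌊⌋ ≤k k≤
... | c , c∈ , Σc≡k = partCounts⇒equitable c Σc≡k (m≤m+n (suc m) r) ≤-refl
  (λ i → Equivalence.to (≤⌊/⌋⇔*≤ (c i) (n i) m) (proj₂ (c∈ i)))
  (λ i → Equivalence.to (⌈/⌉≤⇔≤* (c i) (n i) (m + r)) (proj₁ (c∈ i)))

theorem10 : (r k t : ℕ) (n : Fin t → ℕ) →
    1 ≤ k → 2 ≤ t →
    (∀ i → 1 ≤ n i) →
    (∀ i j → i ≤ᶠ j → n i ≤ n j) →
    HasREquitableColoring t n k r ⇔
      ( (1 ≤ r × k ≥ sumFin t (λ i → ⌈ n i / r ⌉) + 1)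
      ⊎ Σ ℕ (λ m → 1 ≤ m
          × (∀ i → ⌊ n i / m ⌋ ≥ ⌈ n i / m + r ⌉)
          × (sumFin t (λ i → ⌊ n i / m ⌋) ≥ k)
          × (k ≥ sumFin t (λ i → ⌈ n i / m + r ⌉))) )
theorem10 r k t n _ 2≤t n≥1 _ = mk⇔
  (λ (f , proper , equitable) → ProperColoring.equitable⇒condition proper (i₀ , a₀) equitable)
  [ condition₁⇒equitable i₀ , (λ (m , condition) → condition₂⇒equitable m condition) ]′
  where
  i₀ : Fin t
  i₀ = fromℕ< (≤-trans (s≤s z≤n) 2≤t)
  a₀ : Fin (n i₀)
  a₀ = fromℕ< (n≥1 i₀)
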